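{- Let $M$ be a matroid with set of circuits $\mathcal{C}(M)$ and set of cocircuits $\mathcal{C}^*(M)$. Introduce variables $a_{e,X}$ for each pair $X\in\mathcal{C}(M)$, $e\in X$, and variables $b_{e,Y}$ for each pair $Y\in\mathcal{C}^*(M)$, $e\in Y$. Consider the linear system over $F_2$ consisting of the equations $$a_{e,X}+b_{e,Y}+a_{f,X}+b_{f,Y}+1=0$$ for every $X\in\mathcal{C}(M)$ and $Y\in\mathcal{C}^*(M)$ with $X\cap Y=\{e,f\}$ (with $e\ne f$). Then $M$ is weakly-orientable if and only if this linear system has a solution over $F_2$.
   Context: A signed subset of a finite set $E$ is a pair $Z=(Z^+,Z^-)$ of disjoint subsets of $E$; write $-Z=(Z^-,Z^+)$ and $\underline{Z}=Z^+\cup Z^-$. Two signed subsets $X,Y$ are orthogonal if $(X^+\cap Y^+)\cup(X^-\cap Y^-)\neq\varnothing \iff (X^+\cap Y^-)\cup(X^-\cap Y^+)\neq\varnothing$. A matroid $M$ is weakly-orientable if there exist collections $\mathscr{O},\mathscr{O}^*$ of signed subsets of $E(M)$ such that $-\mathscr{O}=\mathscr{O}$, $-\mathscr{O}^*=\mathscr{O}^*$, whenever $X,Z\in\mathscr{O}$ with $\underline{Z}\subseteq\underline{X}$ then $Z=\pm X$ (and likewise for $\mathscr{O}^*$), $\{\underline{X}: X\in\mathscr{O}\}=\mathcal{C}(M)$, $\{\underline{Y}:Y\in\mathscr{O}^*\}=\mathcal{C}^*(M)$, and every $X\in\mathscr{O}$, $Y\in\mathscr{O}^*$ with $|\underline{X}\cap\underline{Y}|=2$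 are orthogonal. -}

module Defs where

open import Data.Nat using (ℕ)
open import Data.Bool using (Bool; true; false; _xor_)
open import Data.Fin using (Fin)
open import Data.Fin.Subset using (Subset; _∈_; _⊆_; _∩_; _∪_; _-_; ⁅_⁆; ∣_∣)
open import Data.Vec using (Vec; map; lookup)
open import Data.Product using (Σ; ∃; ∃-syntax; _×_; _,_)
open import Data.Sum using (_⊎_)
open import Relation.Binary.PropositionalEquality using (_≡_; _≢_)
open import Relation.Nullary using (¬_)

-- Matroids on the finite ground set E = Fin n, given by circuits.
-- A collection of subsets of E is represented by its characteristic
-- function  Subset n → Bool.

record Matroid (n : ℕ) : Set where
  field
    circuit : Subset n → Bool
  IsCircuit : Subset n → Set
  IsCircuit C = circuit C ≡ true
  field
    C1 : ∀ C → IsCircuit C → ∃[ e ] (e ∈ C)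
    C2 : ∀ C D → IsCircuit C → IsCircuit D → C ⊆ D → C ≡ D
    C3 : ∀ C D e → IsCircuit C → IsCircuit D → C ≢ D → e ∈ C → e ∈ D →
         ∃[ F ] (IsCircuit F × F ⊆ ((C ∪ D) - e))

module _ {n : ℕ} (M : Matroid n) where
  open Matroid M

  Independent : Subset n → Set
  Independent I = ∀ C → IsCircuit C → ¬ (C ⊆ I)

  IsBasis : Subset n → Set
  IsBasis B = Independent B × (∀ J → Independent J → B ⊆ J → J ≡ B)

  MeetsAllBases : Subset n → Set
  MeetsAllBases D = ∀ B → IsBasis B → ∃[ e ] (e ∈ D × e ∈ B)

  IsCocircuit : Subset n → Set
  IsCocircuit D = MeetsAllBases D × (∀ D' → D' ⊆ D → MeetsAllBases D' → D' ≡ D)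

-- Signed subsets.  A signed subset Z = (Z⁺, Z⁻) of Fin n (Z⁺, Z⁻ disjoint)
-- is encoded as a vector of signs: plus on Z⁺, minus on Z⁻, zero elsewhere.

data Sign : Set where
  plus minus zero : Sign

SignedSubset : ℕ → Set
SignedSubset n = Vec Sign n

opSign : Sign → Sign
opSign plus = minus
opSign minus = plus
opSign zero = zero

neg : ∀ {n} → SignedSubset n → SignedSubset n
neg = map opSign

isNonzero : Sign → Bool
isNonzero zero = false
isNonzero _ = true

support : ∀ {n} → SignedSubset n → Subset n
support = map isNonzero

Agree : ∀ {n} → SignedSubset n → SignedSubset n → Set
Agree X Y = ∃[ i ] ((lookup X i ≡ plus × lookup Y i ≡ plus) ⊎ (lookup X i ≡ minus × lookup Y i ≡ minus))

Disagree : ∀ {n} → SignedSubset n → SignedSubset n → Set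
Disagree X Y = ∃[ i ] ((lookup X i ≡ plus × lookup Y i ≡ minus) ⊎ (lookup X i ≡ minus × lookup Y i ≡ plus))

Orthogonal : ∀ {n} → SignedSubset n → SignedSubset n → Set
Orthogonal X Y = (Agree X Y → Disagree X Y) × (Disagree X Y → Agree X Y)

SignedCollection : ℕ → Set
SignedCollection n = SignedSubset n → Bool

module _ {n : ℕ} where
  _∈ₛ_ : SignedSubset n → SignedCollection n → Set
  X ∈ₛ 𝒪 = 𝒪 X ≡ true

  SymmetricColl : SignedCollection n → Set
  SymmetricColl 𝒪 = ∀ X → 𝒪 (neg X) ≡ 𝒪 X

  SupportRigid : SignedCollection n → Set
  SupportRigid 𝒪 = ∀ X Z → X ∈ₛ 𝒪 → Z ∈ₛ 𝒪 → support Z ⊆ support X → Z ≡ X ⊎ Z ≡ neg X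

  SupportsAre : SignedCollection n → (Subset n → Set) → Set
  SupportsAre 𝒪 P = (∀ X → X ∈ₛ 𝒪 → P (support X)) × (∀ C → P C → ∃[ X ] (X ∈ₛ 𝒪 × support X ≡ C))

WeaklyOrientable : ∀ {n} → Matroid n → Set
WeaklyOrientable {n} M =
  Σ (SignedCollection n) λ 𝒪 → Σ (SignedCollection n) λ 𝒪* →
    SymmetricColl 𝒪 × SymmetricColl 𝒪* ×
    SupportRigid 𝒪 × SupportRigid 𝒪* ×
    SupportsAre 𝒪 (Matroid.IsCircuit M) × SupportsAre 𝒪* (IsCocircuit M) ×
    (∀ X Y → X ∈ₛ 𝒪 → Y ∈ₛ 𝒪* → ∣ support X ∩ support Y ∣ ≡ 2 → Orthogonal X Y)

-- The linear system over F₂ (F₂ = Bool with _xor_ as addition).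
-- Variables a_{e,X}, b_{e,Y} are given as functions of (X, e) resp. (Y, e);
-- values at pairs with X not a circuit or e ∉ X never occur in an equation.

F2SystemSolvable : ∀ {n} → Matroid n → Set
F2SystemSolvable {n} M =
  Σ (Subset n → Fin n → Bool) λ a → Σ (Subset n → Fin n → Bool) λ b →
    ∀ X Y e f → Matroid.IsCircuit M X → IsCocircuit M Y → e ≢ f →
      X ∩ Y ≡ ⁅ e ⁆ ∪ ⁅ f ⁆ →
      (a X e xor b Y e xor a X f xor b Y f xor true) ≡ false

-- Write F₂ as Bool with _xor_ as addition, and for signed sets X, Y let
-- differ X Y i ∈ F₂ record whether the signs of X and Y at i differ.  The
-- key fact (orthogonal⇔) is local: when the supports of X and Y meet in
-- exactly {e, f}, X and Y are orthogonal iff they agree in sign at exactly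
-- one of e and f, i.e. iff  differ e + differ f = 1.  Reading the sign of a
-- signed circuit X at e as a_{e,X} (plus ↦ 1) and that of a signed cocircuit
-- Y as b_{e,Y}, this is precisely the equation of the system.  Hence:
--  * (⇒) pick, by exhaustive search, one signed set over every circuit and
--    cocircuit and read off a and b from its signs;
--  * (⇐) orient every circuit C by a(C, -) and let 𝒪 consist of these
--    orientations and their negatives (likewise 𝒪* from b); a global sign
--    flip changes differ e and differ f alike (flips-cancel), so the
--    equation still yields orthogonality.

module Submission where

open import Defs
open import Data.Nat using (ℕ; zero; suc; pred)
open import Data.Bool using (Bool; true; false; not; _xor_)
import Data.Bool as Bool
open import Data.Bool.Properties
  using (xor-assoc; xor-same; xor-identityʳ; not-distribʳ-xor; xor-∧-commutativeRing)
open import Algebra.Bundles using (CommutativeRing)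
open import Algebra.Properties.CommutativeSemigroup
  (CommutativeRing.+-commutativeSemigroup xor-∧-commutativeRing)
  using () renaming (interchange to xor-interchange)
open import Data.Fin using (Fin; zero; suc)
open import Data.Fin.Properties using (any?; suc-injective)
open import Data.Fin.Subset using (Subset; _∈_; _⊆_; _∩_; _∪_; ⁅_⁆; ∣_∣; ⊥)
open import Data.Fin.Subset.Properties
  using (anySubset?; _⊆?_; _∈?_; ∣⁅x⁆∣≡1; ∪-identityˡ; ∪-identityʳ;
         x∈p∩q⁺; x∈p∩q⁻; x∈p∪q⁺; x∈p∪q⁻; x∈⁅x⁆; x∈⁅y⁆⇒x≡y)
open import Data.Vec using (Vec; []; _∷_; map; lookup; tabulate)
open import Data.Vec.Properties
  using (≡-dec; []=⇒lookup; lookup⇒[]=; lookup-map; map-∘; map-cong; map-id;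
         lookup∘tabulate; tabulate∘lookup; tabulate-∘; tabulate-cong)
open import Data.Product using (_×_; _,_; proj₁; proj₂; ∃; ∃-syntax)
open import Data.Product.Function.NonDependent.Propositional using (_×-⇔_)
open import Data.Sum using (_⊎_; inj₁; inj₂; [_,_]′)
import Data.Sum as Sum
open import Function using (_∘_; _⇔_; mk⇔; Equivalence)
import Function.Properties.Equivalence as ⇔
open import Function.Related.TypeIsomorphisms using (→-cong-⇔)
open import Relation.Binary.PropositionalEquality
  using (_≡_; _≢_; refl; sym; trans; cong; cong₂; subst; module ≡-Reasoning)
open import Relation.Binary.Definitions using (DecidableEquality)
open import Relation.Nullary using (Dec; yes; no; does; ¬?; contradiction)
open import Relation.Nullary.Decidable
  using (map′; _×-dec_; _⊎-dec_; _→-dec_; dec-true; dec-false; decidable-stable)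
open import Relation.Nullary.Negation using (¬∃⟶∀¬)
open import Relation.Unary using (Decidable)

open Equivalence using (to; from)

equation⇔ : ∀ p q r s →
            (p xor q xor r xor s xor true ≡ false) ⇔ ((p xor q) xor (r xor s) ≡ true)
equation⇔ p q r s = subst (λ t → (t ≡ false) ⇔ (u ≡ true)) (sym regroup) (plus-one⇔ u)
  where
  open ≡-Reasoning
  u : Bool
  u = (p xor q) xor (r xor s)

  plus-one⇔ : ∀ t → (t xor true ≡ false) ⇔ (t ≡ true)
  plus-one⇔ true  = mk⇔ (λ _ → refl) (λ _ → refl)
  plus-one⇔ false = mk⇔ (λ ()) (λ ())

  regroup : p xor q xor r xor s xor true ≡ u xor true
  regroup = begin
    p xor (q xor (r xor (s xor true))) ≡⟨ cong (λ t → p xor (q xor t)) (xor-assoc r s true) ⟨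
    p xor (q xor ((r xor s) xor true)) ≡⟨ xor-assoc p q _ ⟨
    (p xor q) xor ((r xor s) xor true) ≡⟨ xor-assoc (p xor q) (r xor s) true ⟨
    u xor true                         ∎

xor-cancel : ∀ u w c → (u xor c) xor (w xor c) ≡ u xor w
xor-cancel u w c = begin
  (u xor c) xor (w xor c) ≡⟨ xor-interchange u c w c ⟩
  (u xor w) xor (c xor c) ≡⟨ cong ((u xor w) xor_) (xor-same c) ⟩
  (u xor w) xor false     ≡⟨ xor-identityʳ (u xor w) ⟩
  u xor w                 ∎
  where open ≡-Reasoning

-- "One of p, q is 0 iff one of them is 1" — the shape of orthogonality on a
-- two-element meet.
Balanced : Bool → Bool → Set
Balanced p q = ((p ≡ false ⊎ q ≡ false) → (p ≡ true ⊎ q ≡ true))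
             × ((p ≡ true ⊎ q ≡ true) → (p ≡ false ⊎ q ≡ false))

balanced⇔ : ∀ p q → Balanced p q ⇔ (p xor q ≡ true)
balanced⇔ true  true  = mk⇔ (λ b → [ (λ ()) , (λ ()) ]′ (proj₂ b (inj₁ refl))) (λ ())
balanced⇔ false false = mk⇔ (λ b → [ (λ ()) , (λ ()) ]′ (proj₁ b (inj₁ refl))) (λ ())
balanced⇔ true  false = mk⇔ (λ _ → refl) (λ _ → (λ _ → inj₁ refl) , (λ _ → inj₂ refl))
balanced⇔ false true  = mk⇔ (λ _ → refl) (λ _ → (λ _ → inj₂ refl) , (λ _ → inj₁ refl))

dec-true⁻¹ : ∀ {A : Set} (a? : Dec A) → does a? ≡ true → A
dec-true⁻¹ (yes a) _ = a

does-cong : ∀ {A B : Set} → A ⇔ B → (a? : Dec A) (b? : Dec B) → does a? ≡ does b?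
does-cong A⇔B (yes a)  b? = sym (dec-true b? (to A⇔B a))
does-cong A⇔B (no ¬a) b? = sym (dec-false b? (¬a ∘ from A⇔B))

allSubset? : ∀ {n} {P : Subset n → Set} → Decidable P → Dec (∀ S → P S)
allSubset? P? = map′ (λ ¬∃¬P S → decidable-stable (P? S) (¬∃⟶∀¬ ¬∃¬P S))
                     (λ ∀P (S , ¬PS) → ¬PS (∀P S))
                     (¬? (anySubset? (¬? ∘ P?)))

anyBool? : ∀ {Q : Bool → Set} → Decidable Q → Dec (∃ Q)
anyBool? Q? = map′ [ (true ,_) , (false ,_) ]′ cases (Q? true ⊎-dec Q? false)
  where
  cases : ∀ {Q : Bool → Set} → ∃ Q → Q true ⊎ Q false
  cases (true  , q) = inj₁ q
  cases (false , q) = inj₂ q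

anySign? : ∀ {Q : Sign → Set} → Decidable Q → Dec (∃ Q)
anySign? Q? = map′ [ (plus ,_) , [ (minus ,_) , (zero ,_) ]′ ]′ cases
                   (Q? plus ⊎-dec Q? minus ⊎-dec Q? zero)
  where
  cases : ∀ {Q : Sign → Set} → ∃ Q → Q plus ⊎ Q minus ⊎ Q zero
  cases (plus  , q) = inj₁ q
  cases (minus , q) = inj₂ (inj₁ q)
  cases (zero  , q) = inj₂ (inj₂ q)

anyVec? : ∀ {A : Set} → (∀ {Q : A → Set} → Decidable Q → Dec (∃ Q)) →
          ∀ {n} {P : Vec A n → Set} → Decidable P → Dec (∃ P)
anyVec? anyA? {zero}  P? = map′ ([] ,_) (λ { ([] , p) → p }) (P? [])
anyVec? anyA? {suc n} P? =
  map′ (λ (x , xs , p) → x ∷ xs , p) (λ { (x ∷ xs , p) → x , xs , p })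
       (anyA? (λ x → anyVec? anyA? (λ xs → P? (x ∷ xs))))

_≟ˢ_ : DecidableEquality Sign
plus  ≟ˢ plus  = yes refl
minus ≟ˢ minus = yes refl
zero  ≟ˢ zero  = yes refl
plus  ≟ˢ minus = no (λ ())
plus  ≟ˢ zero  = no (λ ())
minus ≟ˢ plus  = no (λ ())
minus ≟ˢ zero  = no (λ ())
zero  ≟ˢ plus  = no (λ ())
zero  ≟ˢ minus = no (λ ())

_≟ₛ_ : ∀ {n} → DecidableEquality (Subset n)
_≟ₛ_ = ≡-dec Bool._≟_

pair-size : ∀ {n} {e f : Fin n} → e ≢ f → ∣ ⁅ e ⁆ ∪ ⁅ f ⁆ ∣ ≡ 2
pair-size {e = zero}  {zero}  e≢f = contradiction refl e≢f
pair-size {e = zero}  {suc f} _   = cong suc (trans (cong ∣_∣ (∪-identityˡ ⁅ f ⁆)) (∣⁅x⁆∣≡1 f))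
pair-size {e = suc e} {zero}  _   = cong suc (trans (cong ∣_∣ (∪-identityʳ ⁅ e ⁆)) (∣⁅x⁆∣≡1 e))
pair-size {e = suc e} {suc f} e≢f = pair-size (e≢f ∘ cong suc)

size-zero : ∀ {n} (S : Subset n) → ∣ S ∣ ≡ 0 → S ≡ ⊥
size-zero []          _ = refl
size-zero (false ∷ S) h = cong (false ∷_) (size-zero S h)

size-one : ∀ {n} (S : Subset n) → ∣ S ∣ ≡ 1 → ∃[ f ] (S ≡ ⁅ f ⁆)
size-one (true  ∷ S) h = zero , cong (true ∷_) (size-zero S (cong pred h))
size-one (false ∷ S) h with f , S≡⁅f⁆ ← size-one S h = suc f , cong (false ∷_) S≡⁅f⁆

size-two : ∀ {n} (S : Subset n) → ∣ S ∣ ≡ 2 → ∃[ e ] ∃[ f ] (e ≢ f × S ≡ ⁅ e ⁆ ∪ ⁅ f ⁆)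
size-two (true ∷ S) h with f , S≡⁅f⁆ ← size-one S (cong pred h) =
  zero , suc f , (λ ()) , cong (true ∷_) (trans S≡⁅f⁆ (sym (∪-identityˡ ⁅ f ⁆)))
size-two (false ∷ S) h with e , f , e≢f , S≡ ← size-two S h =
  suc e , suc f , e≢f ∘ suc-injective , cong (false ∷_) S≡

∈-pair : ∀ {n} {i e f : Fin n} → i ∈ ⁅ e ⁆ ∪ ⁅ f ⁆ → i ≡ e ⊎ i ≡ f
∈-pair {e = e} {f} h = Sum.map (x∈⁅y⁆⇒x≡y e) (x∈⁅y⁆⇒x≡y f) (x∈p∪q⁻ ⁅ e ⁆ ⁅ f ⁆ h)

isPlus : Sign → Bool
isPlus plus = true
isPlus _    = false

module _ {n : ℕ} where

  ∈support⇒nonzero : ∀ {Z : SignedSubset n} {i} → i ∈ support Z → isNonzero (lookup Z i) ≡ true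
  ∈support⇒nonzero {Z} {i} h = trans (sym (lookup-map i isNonzero Z)) ([]=⇒lookup h)

  nonzero⇒∈support : ∀ {Z : SignedSubset n} {i} → isNonzero (lookup Z i) ≡ true → i ∈ support Z
  nonzero⇒∈support {Z} {i} h = lookup⇒[]= i (support Z) (trans (lookup-map i isNonzero Z) h)

  neg-involutive : ∀ (Z : SignedSubset n) → neg (neg Z) ≡ Z
  neg-involutive Z = trans (sym (map-∘ opSign opSign Z)) (trans (map-cong opSign-involutive Z) (map-id Z))
    where
    opSign-involutive : ∀ s → opSign (opSign s) ≡ s
    opSign-involutive plus  = refl
    opSign-involutive minus = refl
    opSign-involutive zero  = refl

  support-neg : ∀ (Z : SignedSubset n) → support (neg Z) ≡ support Z
  support-neg Z = trans (sym (map-∘ isNonzero opSign Z)) (map-cong isNonzero-opSign Z)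
    where
    isNonzero-opSign : ∀ s → isNonzero (opSign s) ≡ isNonzero s
    isNonzero-opSign plus  = refl
    isNonzero-opSign minus = refl
    isNonzero-opSign zero  = refl

-- Agree X Y and Disagree X Y are, by definition,
-- ∃[ i ] SignRel false … and ∃[ i ] SignRel true … at the entries of X, Y.
SignRel : Bool → Sign → Sign → Set
SignRel false x y = (x ≡ plus × y ≡ plus) ⊎ (x ≡ minus × y ≡ minus)
SignRel true  x y = (x ≡ plus × y ≡ minus) ⊎ (x ≡ minus × y ≡ plus)

signRel-sound : ∀ v x y → SignRel v x y →
                isNonzero x ≡ true × isNonzero y ≡ true × isPlus x xor isPlus y ≡ v
signRel-sound false _ _ (inj₁ (refl , refl)) = refl , refl , refl
signRel-sound false _ _ (inj₂ (refl , refl)) = refl , refl , refl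
signRel-sound true  _ _ (inj₁ (refl , refl)) = refl , refl , refl
signRel-sound true  _ _ (inj₂ (refl , refl)) = refl , refl , refl

signRel-complete : ∀ x y → isNonzero x ≡ true → isNonzero y ≡ true →
                   SignRel (isPlus x xor isPlus y) x y
signRel-complete plus  plus  _ _ = inj₁ (refl , refl)
signRel-complete plus  minus _ _ = inj₁ (refl , refl)
signRel-complete minus plus  _ _ = inj₂ (refl , refl)
signRel-complete minus minus _ _ = inj₂ (refl , refl)
signRel-complete zero  _     () _
signRel-complete plus  zero  _ ()
signRel-complete minus zero  _ ()

differ : ∀ {n} → SignedSubset n → SignedSubset n → Fin n → Bool
differ X Y i = isPlus (lookup X i) xor isPlus (lookup Y i)

module _ {n : ℕ} (X Y : SignedSubset n) {e f : Fin n}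
         (meet : support X ∩ support Y ≡ ⁅ e ⁆ ∪ ⁅ f ⁆) where

  pair⊆supports : ∀ {i} → i ∈ ⁅ e ⁆ ∪ ⁅ f ⁆ → i ∈ support X × i ∈ support Y
  pair⊆supports h = x∈p∩q⁻ (support X) (support Y) (subst (_ ∈_) (sym meet) h)

  e∈pair : e ∈ ⁅ e ⁆ ∪ ⁅ f ⁆
  e∈pair = x∈p∪q⁺ (inj₁ (x∈⁅x⁆ e))

  f∈pair : f ∈ ⁅ e ⁆ ∪ ⁅ f ⁆
  f∈pair = x∈p∪q⁺ (inj₂ (x∈⁅x⁆ f))

  -- A sign relation of type v holds somewhere iff it holds at e or at f,
  -- since both signs are nonzero exactly on the meet {e, f}.
  signRel-on-pair : ∀ v → (∃[ i ] SignRel v (lookup X i) (lookup Y i))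
                          ⇔ (differ X Y e ≡ v ⊎ differ X Y f ≡ v)
  signRel-on-pair v = mk⇔ located [ witness e∈pair , witness f∈pair ]′
    where
    located : ∃[ i ] SignRel v (lookup X i) (lookup Y i) → differ X Y e ≡ v ⊎ differ X Y f ≡ v
    located (i , r) with nzX , nzY , differ≡v ← signRel-sound v _ _ r =
      Sum.map (λ { refl → differ≡v }) (λ { refl → differ≡v })
              (∈-pair (subst (i ∈_) meet (x∈p∩q⁺ (nonzero⇒∈support nzX , nonzero⇒∈support nzY))))

    witness : ∀ {i} → i ∈ ⁅ e ⁆ ∪ ⁅ f ⁆ → differ X Y i ≡ v → ∃[ i ] SignRel v (lookup X i) (lookup Y i)
    witness {i} h refl with i∈X , i∈Y ← pair⊆supports h =
      i , signRel-complete _ _ (∈support⇒nonzero i∈X) (∈support⇒nonzero i∈Y)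

  -- X ⊥ Y iff their signs agree at exactly one of e, f: rewrite Agree and
  -- Disagree by signRel-on-pair, and what remains is balanced⇔.
  orthogonal⇔ : Orthogonal X Y ⇔ (differ X Y e xor differ X Y f ≡ true)
  orthogonal⇔ =
    ⇔.trans (→-cong-⇔ (signRel-on-pair false) (signRel-on-pair true) ×-⇔
             →-cong-⇔ (signRel-on-pair true) (signRel-on-pair false))
            (balanced⇔ (differ X Y e) (differ X Y f))

  flips-cancel : ∀ (p q : Fin n → Bool) {ε δ : Bool} →
                 (∀ i → i ∈ support X → isPlus (lookup X i) ≡ p i xor ε) →
                 (∀ i → i ∈ support Y → isPlus (lookup Y i) ≡ q i xor δ) →
                 differ X Y e xor differ X Y f ≡ (p e xor q e) xor (p f xor q f)
  flips-cancel p q {ε} {δ} X-signs Y-signs = begin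
    differ X Y e xor differ X Y f
      ≡⟨ cong₂ _xor_ (differ-on-pair e∈pair) (differ-on-pair f∈pair) ⟩
    ((p e xor q e) xor (ε xor δ)) xor ((p f xor q f) xor (ε xor δ))
      ≡⟨ xor-cancel (p e xor q e) (p f xor q f) (ε xor δ) ⟩
    (p e xor q e) xor (p f xor q f) ∎
    where
    open ≡-Reasoning
    differ-on-pair : ∀ {i} → i ∈ ⁅ e ⁆ ∪ ⁅ f ⁆ → differ X Y i ≡ (p i xor q i) xor (ε xor δ)
    differ-on-pair {i} h with i∈X , i∈Y ← pair⊆supports h = begin
      isPlus (lookup X i) xor isPlus (lookup Y i) ≡⟨ cong₂ _xor_ (X-signs i i∈X) (Y-signs i i∈Y) ⟩
      (p i xor ε) xor (q i xor δ)                 ≡⟨ xor-interchange (p i) ε (q i) δ ⟩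
      (p i xor q i) xor (ε xor δ)                 ∎

module Decide {n : ℕ} (M : Matroid n) where
  open Matroid M

  independent? : Decidable (Independent M)
  independent? I = allSubset? (λ C → (circuit C Bool.≟ true) →-dec ¬? (C ⊆? I))

  basis? : Decidable (IsBasis M)
  basis? B = independent? B ×-dec allSubset? (λ J → independent? J →-dec (B ⊆? J →-dec J ≟ₛ B))

  meetsAllBases? : Decidable (MeetsAllBases M)
  meetsAllBases? D = allSubset? (λ B → basis? B →-dec any? (λ e → (e ∈? D) ×-dec (e ∈? B)))

  cocircuit? : Decidable (IsCocircuit M)
  cocircuit? D = meetsAllBases? D ×-dec
                 allSubset? (λ D′ → D′ ⊆? D →-dec (meetsAllBases? D′ →-dec D′ ≟ₛ D))

module Representatives {n : ℕ} (𝒪 : SignedCollection n) where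

  Represented : Subset n → Set
  Represented C = ∃[ X ] (X ∈ₛ 𝒪 × support X ≡ C)

  represented? : Decidable Represented
  represented? C = anyVec? anySign? (λ X → (𝒪 X Bool.≟ true) ×-dec (support X ≟ₛ C))

  -- The sign bits of the representative found by the search (0 if none).
  signsOf : ∀ {C} → Dec (Represented C) → Fin n → Bool
  signsOf (yes (X , _)) i = isPlus (lookup X i)
  signsOf (no _)        _ = false

  signs : Subset n → Fin n → Bool
  signs C = signsOf (represented? C)

  signs-spec : ∀ C → Represented C →
               ∃[ X ] (X ∈ₛ 𝒪 × support X ≡ C × ∀ i → signs C i ≡ isPlus (lookup X i))
  signs-spec C = spec (represented? C)
    where
    spec : (d : Dec (Represented C)) → Represented C →
           ∃[ X ] (X ∈ₛ 𝒪 × support X ≡ C × ∀ i → signsOf d i ≡ isPlus (lookup X i))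
    spec (yes (X , X∈𝒪 , X-over-C)) _ = X , X∈𝒪 , X-over-C , λ _ → refl
    spec (no ¬r) r = contradiction r ¬r

forward : ∀ {n} (M : Matroid n) → WeaklyOrientable M → F2SystemSolvable M
forward M (𝒪 , 𝒪* , _ , _ , _ , _ , (_ , circuits-signed) , (_ , cocircuits-signed) , orthogonal) =
  signs 𝒪 , signs 𝒪* , solves
  where
  open Representatives
  solves : ∀ C D e f → Matroid.IsCircuit M C → IsCocircuit M D → e ≢ f → C ∩ D ≡ ⁅ e ⁆ ∪ ⁅ f ⁆ →
           (signs 𝒪 C e xor signs 𝒪* D e xor signs 𝒪 C f xor signs 𝒪* D f xor true) ≡ false
  solves C D e f C-circuit D-cocircuit e≢f meet
    with X , X∈𝒪 , refl , X-signs ← signs-spec 𝒪 C (circuits-signed C C-circuit)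
       | Y , Y∈𝒪* , refl , Y-signs ← signs-spec 𝒪* D (cocircuits-signed D D-cocircuit)
    rewrite X-signs e | X-signs f | Y-signs e | Y-signs f =
    from (equation⇔ (isPlus (lookup X e)) (isPlus (lookup Y e)) (isPlus (lookup X f)) (isPlus (lookup Y f)))
         (to (orthogonal⇔ X Y meet) (orthogonal X Y X∈𝒪 Y∈𝒪* (trans (cong ∣_∣ meet) (pair-size e≢f))))

signOn : Bool → Bool → Sign
signOn false _     = zero
signOn true  true  = plus
signOn true  false = minus

orient : ∀ {n} → (Fin n → Bool) → Bool → Subset n → SignedSubset n
orient h ε S = tabulate (λ i → signOn (lookup S i) (h i xor ε))

module _ {n : ℕ} (h : Fin n → Bool) (S : Subset n) where

  support-orient : ∀ ε → support (orient h ε S) ≡ S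
  support-orient ε = begin
    map isNonzero (tabulate _) ≡⟨ tabulate-∘ isNonzero _ ⟨
    tabulate (λ i → isNonzero (signOn (lookup S i) (h i xor ε)))
      ≡⟨ tabulate-cong (λ i → isNonzero-signOn (lookup S i) (h i xor ε)) ⟩
    tabulate (lookup S)        ≡⟨ tabulate∘lookup S ⟩
    S                          ∎
    where
    open ≡-Reasoning
    isNonzero-signOn : ∀ b c → isNonzero (signOn b c) ≡ b
    isNonzero-signOn false _     = refl
    isNonzero-signOn true  true  = refl
    isNonzero-signOn true  false = refl

  isPlus-orient : ∀ ε {i} → i ∈ S → isPlus (lookup (orient h ε S) i) ≡ h i xor ε
  isPlus-orient ε {i} i∈S = begin
    isPlus (lookup (orient h ε S) i)         ≡⟨ cong isPlus (lookup∘tabulate _ i) ⟩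
    isPlus (signOn (lookup S i) (h i xor ε)) ≡⟨ cong (λ b → isPlus (signOn b (h i xor ε))) ([]=⇒lookup i∈S) ⟩
    isPlus (signOn true (h i xor ε))         ≡⟨ isPlus-signOn (h i xor ε) ⟩
    h i xor ε                                ∎
    where
    open ≡-Reasoning
    isPlus-signOn : ∀ c → isPlus (signOn true c) ≡ c
    isPlus-signOn true  = refl
    isPlus-signOn false = refl

  neg-orient : ∀ ε → neg (orient h ε S) ≡ orient h (not ε) S
  neg-orient ε = trans (sym (tabulate-∘ opSign _)) (tabulate-cong flip-at)
    where
    opSign-signOn : ∀ b c → opSign (signOn b c) ≡ signOn b (not c)
    opSign-signOn false _     = refl
    opSign-signOn true  true  = refl
    opSign-signOn true  false = refl
    flip-at : ∀ i → opSign (signOn (lookup S i) (h i xor ε)) ≡ signOn (lookup S i) (h i xor not ε)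
    flip-at i = trans (opSign-signOn (lookup S i) (h i xor ε))
                      (cong (signOn (lookup S i)) (not-distribʳ-xor (h i) ε))

  orient-± : ∀ ε δ → orient h δ S ≡ orient h ε S ⊎ orient h δ S ≡ neg (orient h ε S)
  orient-± false false = inj₁ refl
  orient-± true  true  = inj₁ refl
  orient-± false true  = inj₂ (sym (neg-orient false))
  orient-± true  false = inj₂ (sym (neg-orient true))

module OrientedCollection {n : ℕ} {Q : Subset n → Set} (Q? : Decidable Q)
                          (g : Subset n → Fin n → Bool) where

  Member : SignedSubset n → Set
  Member Z = Q (support Z) × ∃[ ε ] (Z ≡ orient (g (support Z)) ε (support Z))

  member? : Decidable Member
  member? Z = Q? (support Z) ×-dec
              anyBool? (λ ε → ≡-dec _≟ˢ_ Z (orient (g (support Z)) ε (support Z)))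

  𝒪 : SignedCollection n
  𝒪 Z = does (member? Z)

  member : ∀ {Z} → Z ∈ₛ 𝒪 → Member Z
  member {Z} = dec-true⁻¹ (member? Z)

  member-neg : ∀ Z → Member Z → Member (neg Z)
  member-neg Z (q , ε , Z≡) rewrite support-neg Z =
    q , not ε , trans (cong neg Z≡) (neg-orient (g (support Z)) (support Z) ε)

  symmetric : SymmetricColl 𝒪
  symmetric Z = does-cong Member-neg⇔ (member? (neg Z)) (member? Z)
    where
    Member-neg⇔ : Member (neg Z) ⇔ Member Z
    Member-neg⇔ = mk⇔ (subst Member (neg-involutive Z) ∘ member-neg (neg Z)) (member-neg Z)

  rigid : (∀ S T → Q S → Q T → S ⊆ T → S ≡ T) → SupportRigid 𝒪
  rigid incomparable X Z X∈𝒪 Z∈𝒪 Z⊆X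
    with qX , ε , X≡ ← member X∈𝒪 | qZ , δ , Z≡ ← member Z∈𝒪 =
    Sum.map (λ same → trans Z≡′ (trans same (sym X≡)))
            (λ opposite → trans Z≡′ (trans opposite (cong neg (sym X≡))))
            (orient-± (g (support X)) (support X) ε δ)
    where
    Z≡′ : Z ≡ orient (g (support X)) δ (support X)
    Z≡′ = subst (λ S → Z ≡ orient (g S) δ S) (incomparable _ _ qZ qX Z⊆X) Z≡

  supports : SupportsAre 𝒪 Q
  supports = (λ Z Z∈𝒪 → proj₁ (member Z∈𝒪)) ,
             (λ C q → orient (g C) false C ,
                      dec-true (member? _) (canonical C q) , support-orient (g C) C false)
    where
    canonical : ∀ C → Q C → Member (orient (g C) false C)
    canonical C q rewrite support-orient (g C) C false = q , false , refl

  signs : ∀ {Z} → Z ∈ₛ 𝒪 →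
          ∃[ ε ] (∀ i → i ∈ support Z → isPlus (lookup Z i) ≡ g (support Z) i xor ε)
  signs {Z} Z∈𝒪 with _ , ε , Z≡ ← member Z∈𝒪 =
    ε , λ i i∈Z → trans (cong (λ W → isPlus (lookup W i)) Z≡)
                        (isPlus-orient (g (support Z)) (support Z) ε i∈Z)

backward : ∀ {n} (M : Matroid n) → F2SystemSolvable M → WeaklyOrientable M
backward M (a , b , solves) =
  Circ.𝒪 , Cocirc.𝒪 , Circ.symmetric , Cocirc.symmetric ,
  Circ.rigid (Matroid.C2 M) , Cocirc.rigid cocircuits-incomparable ,
  Circ.supports , Cocirc.supports , orthogonal
  where
  module Circ = OrientedCollection (λ C → Matroid.circuit M C Bool.≟ true) a
  module Cocirc = OrientedCollection (Decide.cocircuit? M) b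

  cocircuits-incomparable : ∀ S T → IsCocircuit M S → IsCocircuit M T → S ⊆ T → S ≡ T
  cocircuits-incomparable S T (S-meets , _) (_ , T-minimal) S⊆T = T-minimal S S⊆T S-meets

  orthogonal : ∀ X Y → X ∈ₛ Circ.𝒪 → Y ∈ₛ Cocirc.𝒪 → ∣ support X ∩ support Y ∣ ≡ 2 → Orthogonal X Y
  orthogonal X Y X∈𝒪 Y∈𝒪* meet-size
    with e , f , e≢f , meet ← size-two _ meet-size
       | _ , X-signs ← Circ.signs X∈𝒪 | _ , Y-signs ← Cocirc.signs Y∈𝒪* =
    from (orthogonal⇔ X Y meet)
         (trans (flips-cancel X Y meet (a (support X)) (b (support Y)) X-signs Y-signs)
                (to (equation⇔ (a (support X) e) (b (support Y) e) (a (support X) f) (b (support Y) f))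
                    (solves _ _ e f (proj₁ (Circ.member X∈𝒪)) (proj₁ (Cocirc.member Y∈𝒪*)) e≢f meet)))

theorem2p7 : (n : ℕ) (M : Matroid n) →
    (WeaklyOrientable M → F2SystemSolvable M) × (F2SystemSolvable M → WeaklyOrientable M)
theorem2p7 n M = forward M , backward M
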